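{- Let $n\ge2$, $\ell\ge1$, and $f=a\,m_2(\mathbf x_1)+b\,m_{1,1}(\mathbf x_1)$ with $a,b\in\mathbb R$. If $a\ne0$ and $b\ne2a$, then for each $i$ with $1\le i\le\ell$ the set $$\{E_{i,1}\partial_{1j}(f):1\le j\le n-1\}\cup\{E^{(2)}_{i,1}(f)\}$$ is linearly independent.
   Context: $X=(x_{ij})_{1\le i\le\ell,1\le j\le n}$ commuting variables, $\mathbf x_1=(x_{11},\dots,x_{1n})$; $m_2=\sum_jx_{1j}^2$, $m_{1,1}=\sum_{p<q}x_{1p}x_{1q}$. $\partial_{1j}=\partial/\partial x_{1j}$; $E^{(p)}_{i,k}=\sum_{j=1}^nx_{ij}\,\partial^p/\partial x_{kj}^p$ and $E_{i,k}=E^{(1)}_{i,k}$. -}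

module Defs where

open import Level using (Level; _⊔_)
open import Data.Nat as ℕ using (ℕ; zero; suc)
open import Data.Fin as Fin using (Fin)
open import Data.Vec as Vec using (Vec)
open import Data.Vec.Properties using (≡-dec)
open import Data.List as List using (List; []; _∷_; _++_)
open import Data.Product using (_×_; _,_; ∃)
open import Relation.Nullary using (¬_; does)
open import Data.Bool using (if_then_else_; _∧_)
open import Algebra.Bundles using (CommutativeRing)
import Algebra.Definitions.RawMonoid as RawMonoidDefs

record IsCharZeroField {c ℓ : Level} (R : CommutativeRing c ℓ) : Set (c ⊔ ℓ) where
  open CommutativeRing R
  open RawMonoidDefs +-rawMonoid using () renaming (_×_ to _·ℕ_)
  field
    1≉0      : ¬ (1# ≈ 0#)
    inverse  : ∀ x → ¬ (x ≈ 0#) → ∃ λ y → x * y ≈ 1#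
    charZero : ∀ k → ¬ ((suc k ·ℕ 1#) ≈ 0#)

-- A polynomial is a finite formal sum of terms (coefficient, exponent matrix);
-- two polynomials are equal iff all their monomial coefficients agree.
module Poly {c ℓ : Level} (R : CommutativeRing c ℓ) (rows cols : ℕ) where
  open CommutativeRing R
  open RawMonoidDefs +-rawMonoid using () renaming (_×_ to _·ℕ_)

  Mon : Set
  Mon = Vec (Vec ℕ cols) rows

  Pol : Set c
  Pol = List (Carrier × Mon)

  _≟M_ : (m m′ : Mon) → _
  m ≟M m′ = ≡-dec (≡-dec ℕ._≟_) m m′

  coeff : Pol → Mon → Carrier
  coeff []            m = 0#
  coeff ((d , m′) ∷ p) m = if does (m′ ≟M m) then d + coeff p m else coeff p m

  _≈P_ : Pol → Pol → Set ℓ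
  p ≈P q = ∀ m → coeff p m ≈ coeff q m

  0P : Pol
  0P = []

  _+P_ : Pol → Pol → Pol
  p +P q = p ++ q

  _·P_ : Carrier → Pol → Pol
  a ·P p = List.map (λ { (d , m) → (a * d , m) }) p

  _*P_ : Pol → Pol → Pol
  p *P q = List.concatMap
             (λ { (d , m) → List.map (λ { (e , m′) → (d * e , Vec.zipWith (Vec.zipWith ℕ._+_) m m′) }) q })
             p

  var : Fin rows → Fin cols → Pol
  var i j = (1# , Vec.tabulate (λ i′ → Vec.tabulate (λ j′ →
              if does (i′ Fin.≟ i) ∧ does (j′ Fin.≟ j) then 1 else 0))) ∷ []

  ΣP : (k : ℕ) → (Fin k → Pol) → Pol
  ΣP k f = List.foldr _+P_ 0P (List.map f (List.allFin k))

  ∂ : Fin rows → Fin cols → Pol → Pol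
  ∂ i j = List.map (λ { (d , m) →
            (Vec.lookup (Vec.lookup m i) j ·ℕ d , Vec.updateAt m i (λ r → Vec.updateAt r j ℕ.pred)) })

  ∂^ : ℕ → Fin rows → Fin cols → Pol → Pol
  ∂^ zero    i j p = p
  ∂^ (suc k) i j p = ∂ i j (∂^ k i j p)

  E^ : ℕ → Fin rows → Fin rows → Pol → Pol
  E^ p i k f = ΣP cols (λ j → var i j *P ∂^ p k j f)

  E : Fin rows → Fin rows → Pol → Pol
  E = E^ 1

  m₂ : Fin rows → Pol
  m₂ r = ΣP cols (λ j → var r j *P var r j)

  m₁₁ : Fin rows → Pol
  m₁₁ r = ΣP cols (λ p → ΣP cols (λ q →
            if does (Fin.toℕ p ℕ.<? Fin.toℕ q) then var r p *P var r q else 0P))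

  LinearlyIndependent : {k : ℕ} → (Fin k → Pol) → Set (c ⊔ ℓ)
  LinearlyIndependent {k} v =
    (γ : Fin k → Carrier) → ΣP k (λ t → γ t ·P v t) ≈P 0P → ∀ t → γ t ≈ 0#

-- Every member of the family is a linear form in the row x_i. Indeed f is a quadratic form in x_1 whose
-- Hessian H has 2a on the diagonal and b off it, so E^{(2)}_{i,1} f = Σ_s H_ss x_is and
-- E_{i,1} ∂_{1j} f = Σ_s H_js x_is. In a vanishing combination γ_0 E^{(2)}_{i,1} f + Σ_j γ_j E_{i,1} ∂_{1j} f
-- the coefficients of x_ij (j < n) and of x_in differ by (2a − b) γ_j, so every γ_j vanishes, and then the
-- coefficient 2a γ_0 of x_in forces γ_0 = 0; 2a ≠ 0 needs characteristic zero.
--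
-- Coefficients are read off through the pairing ⟪ p ∣ N ⟫ = Σ d · N(M) of a polynomial with an ℕ-valued
-- weight N on exponent matrices. Multiplication by a variable and ∂ act on weights by pullback (N ∘ (unit ⊕_)
-- and ∂ᵀ), which avoids proving that ∂ respects the coefficientwise equality of term lists.

module Submission where

open import Defs
open import Level using (Level)
open import Data.Bool using (true; false; if_then_else_; _∧_)
open import Function using (_∘_)
open import Data.Nat as ℕ using (ℕ; zero; suc; _≤_)
import Data.Nat.Properties as ℕₚ
open import Data.Fin as Fin using (Fin; zero; suc; toℕ; inject₁; fromℕ)
import Data.Fin.Properties as Finₚ
open import Data.Empty using (⊥-elim)
open import Data.Product using (_,_)
open import Relation.Nullary using (¬_; Dec; does; yes; no)
open import Relation.Nullary.Decidable using (dec-true; dec-false)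
open import Relation.Binary using (tri<; tri≈; tri>)
open import Relation.Binary.PropositionalEquality as ≡ using (_≡_; _≢_; refl; cong; cong₂)
open import Algebra.Bundles using (Semiring; CommutativeRing)
import Algebra.Properties.Semiring.Sum as SemiringSum
import Algebra.Properties.Semiring.Mult as SemiringMult
open import Data.Nat.Tactic.RingSolver using (solve-∀)

𝟙 : ∀ {p} {P : Set p} → Dec P → ℕ
𝟙 P? = if does P? then 1 else 0

δ : ∀ {n} → Fin n → Fin n → ℕ
δ x y = 𝟙 (x Fin.≟ y)

δ-refl : ∀ {n} (x : Fin n) → δ x x ≡ 1
δ-refl x = cong (λ b → if b then 1 else 0) (dec-true (x Fin.≟ x) refl)

δ-≢ : ∀ {n} {x y : Fin n} → x ≢ y → δ x y ≡ 0
δ-≢ {x = x} {y} x≢y = cong (λ b → if b then 1 else 0) (dec-false (x Fin.≟ y) x≢y)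

𝟙[<]-irrefl : ∀ {n} (x : Fin n) → 𝟙 (toℕ x ℕ.<? toℕ x) ≡ 0
𝟙[<]-irrefl x = cong (λ b → if b then 1 else 0) (dec-false (toℕ x ℕ.<? toℕ x) (ℕₚ.<-irrefl refl))

𝟙[<]-connex : ∀ {n} {x y : Fin n} → x ≢ y → 𝟙 (toℕ x ℕ.<? toℕ y) ℕ.+ 𝟙 (toℕ y ℕ.<? toℕ x) ≡ 1
𝟙[<]-connex {x = x} {y} x≢y with Finₚ.<-cmp x y
... | tri< x<y _ y≮x rewrite dec-true (toℕ x ℕ.<? toℕ y) x<y | dec-false (toℕ y ℕ.<? toℕ x) y≮x = refl
... | tri≈ _ x≡y _ = ⊥-elim (x≢y x≡y)
... | tri> x≮y _ y<x rewrite dec-false (toℕ x ℕ.<? toℕ y) x≮y | dec-true (toℕ y ℕ.<? toℕ x) y<x = refl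

module Selection {c ℓ} (S : Semiring c ℓ) where
  open Semiring S hiding (zero)
  open SemiringSum S
  open SemiringMult S
  open import Relation.Binary.Reasoning.Setoid setoid

  ∑-select : ∀ {n} (x : Fin n) (g : Fin n → Carrier) → ∑[ j < n ] (δ x j × g j) ≈ g x
  ∑-select {suc n} zero g = begin
    (g zero + 0#) + ∑[ j < n ] 0# ≈⟨ +-cong (+-identityʳ _) (sum-replicate-zero n) ⟩
    g zero + 0#                   ≈⟨ +-identityʳ _ ⟩
    g zero                        ∎
  ∑-select {suc n} (suc x) g = trans (+-identityˡ _) (∑-select x (λ j → g (suc j)))

module ℕ∑ = SemiringSum ℕₚ.+-*-semiring
open SemiringMult ℕₚ.+-*-semiring using () renaming (_×_ to _×ℕ_)

𝟙*≡𝟙× : ∀ {p} {P : Set p} (P? : Dec P) n → 𝟙 P? ℕ.* n ≡ 𝟙 P? ×ℕ n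
𝟙*≡𝟙× P? n with does P?
... | true  = refl
... | false = refl

∑δ-select : ∀ {n} (x : Fin n) (g : Fin n → ℕ) → ℕ∑.sum (λ p → δ x p ℕ.* g p) ≡ g x
∑δ-select x g = ≡.trans (ℕ∑.sum-cong-≋ (λ p → 𝟙*≡𝟙× (x Fin.≟ p) (g p)))
                        (Selection.∑-select ℕₚ.+-*-semiring x g)

∑∑δ-select : ∀ {n} (x y : Fin n) (g : Fin n → Fin n → ℕ) →
  ℕ∑.sum (λ p → ℕ∑.sum (λ q → δ x p ℕ.* (δ y q ℕ.* g p q))) ≡ g x y
∑∑δ-select x y g = begin
  ℕ∑.sum (λ p → ℕ∑.sum (λ q → δ x p ℕ.* (δ y q ℕ.* g p q)))
    ≡⟨ ℕ∑.sum-cong-≋ (λ p → ≡.sym (ℕ∑.*-distribˡ-sum (δ x p) (λ q → δ y q ℕ.* g p q))) ⟩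
  ℕ∑.sum (λ p → δ x p ℕ.* ℕ∑.sum (λ q → δ y q ℕ.* g p q))
    ≡⟨ ∑δ-select x (λ p → ℕ∑.sum (λ q → δ y q ℕ.* g p q)) ⟩
  ℕ∑.sum (λ q → δ y q ℕ.* g x q)
    ≡⟨ ∑δ-select y (g x) ⟩
  g x y ∎
  where open ≡.≡-Reasoning

-- unit, _⊕_ and lower are the exponent operations inlined in the definitions of var, _*P_ and ∂, written
-- identically so that those definitions unfold to them.
module Monomials (rows cols : ℕ) where
  open import Data.Vec using (Vec; lookup; tabulate; zipWith; updateAt; replicate)
  import Data.Vec.Properties as Vecₚ
  open import Data.Nat using (_+_; _*_; _∸_; _≤_; z≤n; s≤s)

  Mon : Set
  Mon = Vec (Vec ℕ cols) rows

  _[_,_] : Mon → Fin rows → Fin cols → ℕ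
  M [ r , s ] = lookup (lookup M r) s

  unit : Fin rows → Fin cols → Mon
  unit i j = tabulate (λ i′ → tabulate (λ j′ →
               if does (i′ Fin.≟ i) ∧ does (j′ Fin.≟ j) then 1 else 0))

  _⊕_ : Mon → Mon → Mon
  M ⊕ M′ = zipWith (zipWith _+_) M M′

  lower : Fin rows → Fin cols → Mon → Mon
  lower i j M = updateAt M i (λ r → updateAt r j ℕ.pred)

  𝟎 : Mon
  𝟎 = replicate rows (replicate cols 0)

  Mon-ext : ∀ {M M′} → (∀ r s → M [ r , s ] ≡ M′ [ r , s ]) → M ≡ M′
  Mon-ext {M} {M′} eq = ≡.trans (≡.sym (Vecₚ.tabulate∘lookup M))
    (≡.trans (Vecₚ.tabulate-cong row-eq) (Vecₚ.tabulate∘lookup M′))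
    where
    row-eq : ∀ r → lookup M r ≡ lookup M′ r
    row-eq r = ≡.trans (≡.sym (Vecₚ.tabulate∘lookup (lookup M r)))
      (≡.trans (Vecₚ.tabulate-cong (eq r)) (Vecₚ.tabulate∘lookup (lookup M′ r)))

  unit-entry : ∀ i j r s → unit i j [ r , s ] ≡ (if does (r Fin.≟ i) ∧ does (s Fin.≟ j) then 1 else 0)
  unit-entry i j r s = ≡.trans (cong (λ v → lookup v s) (Vecₚ.lookup∘tabulate _ r)) (Vecₚ.lookup∘tabulate _ s)

  ⊕-entry : ∀ M M′ r s → (M ⊕ M′) [ r , s ] ≡ M [ r , s ] + M′ [ r , s ]
  ⊕-entry M M′ r s = ≡.trans (cong (λ v → lookup v s) (Vecₚ.lookup-zipWith _ r M M′))
                             (Vecₚ.lookup-zipWith _ s (lookup M r) (lookup M′ r))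

  pred≡∸1 : ∀ n → ℕ.pred n ≡ n ∸ 1
  pred≡∸1 zero    = refl
  pred≡∸1 (suc n) = refl

  lower-entry : ∀ i j M r s → lower i j M [ r , s ] ≡ M [ r , s ] ∸ unit i j [ r , s ]
  lower-entry i j M r s rewrite unit-entry i j r s with r Fin.≟ i
  ... | no r≢i = cong (λ v → lookup v s) (Vecₚ.lookup∘updateAt′ r i r≢i M)
  ... | yes refl with s Fin.≟ j
  ...   | yes refl = ≡.trans (cong (λ v → lookup v s) (Vecₚ.lookup∘updateAt r M))
                       (≡.trans (Vecₚ.lookup∘updateAt s (lookup M r)) (pred≡∸1 (M [ r , s ])))
  ...   | no s≢j = ≡.trans (cong (λ v → lookup v s) (Vecₚ.lookup∘updateAt r M))
                     (Vecₚ.lookup∘updateAt′ s j s≢j (lookup M r))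

  𝟎-entry : ∀ r s → 𝟎 [ r , s ] ≡ 0
  𝟎-entry r s = ≡.trans (cong (λ v → lookup v s) (Vecₚ.lookup-replicate r _)) (Vecₚ.lookup-replicate s 0)

  unit-diag : ∀ r j s → unit r j [ r , s ] ≡ δ s j
  unit-diag r j s rewrite unit-entry r j r s | dec-true (r Fin.≟ r) refl = refl

  ⊕-identityʳ : ∀ M → M ⊕ 𝟎 ≡ M
  ⊕-identityʳ M = Mon-ext λ r s →
    ≡.trans (⊕-entry M 𝟎 r s) (≡.trans (cong (M [ r , s ] +_) (𝟎-entry r s)) (ℕₚ.+-identityʳ _))

  lower-unit-⊕ : ∀ r j M → lower r j (unit r j ⊕ M) ≡ M
  lower-unit-⊕ r j M = Mon-ext λ r′ s → begin
    lower r j (unit r j ⊕ M) [ r′ , s ]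
      ≡⟨ lower-entry r j (unit r j ⊕ M) r′ s ⟩
    (unit r j ⊕ M) [ r′ , s ] ∸ unit r j [ r′ , s ]
      ≡⟨ cong (_∸ unit r j [ r′ , s ]) (⊕-entry (unit r j) M r′ s) ⟩
    unit r j [ r′ , s ] + M [ r′ , s ] ∸ unit r j [ r′ , s ]
      ≡⟨ ℕₚ.m+n∸m≡n (unit r j [ r′ , s ]) (M [ r′ , s ]) ⟩
    M [ r′ , s ] ∎
    where open ≡.≡-Reasoning

  unit≤ : ∀ r j M → 1 ≤ M [ r , j ] → ∀ r′ s → unit r j [ r′ , s ] ≤ M [ r′ , s ]
  unit≤ r j M 1≤M r′ s rewrite unit-entry r j r′ s with r′ Fin.≟ r | s Fin.≟ j
  ... | yes refl | yes refl = 1≤M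
  ... | yes _    | no _     = z≤n
  ... | no _     | _        = z≤n

  unit-⊕-lower : ∀ r j M → 1 ≤ M [ r , j ] → unit r j ⊕ lower r j M ≡ M
  unit-⊕-lower r j M 1≤M = Mon-ext λ r′ s → begin
    (unit r j ⊕ lower r j M) [ r′ , s ]
      ≡⟨ ⊕-entry (unit r j) (lower r j M) r′ s ⟩
    unit r j [ r′ , s ] + lower r j M [ r′ , s ]
      ≡⟨ cong (unit r j [ r′ , s ] +_) (lower-entry r j M r′ s) ⟩
    unit r j [ r′ , s ] + (M [ r′ , s ] ∸ unit r j [ r′ , s ])
      ≡⟨ ℕₚ.m+[n∸m]≡n (unit≤ r j M 1≤M r′ s) ⟩
    M [ r′ , s ] ∎
    where open ≡.≡-Reasoning

  lower-unit-comm : ∀ r j p M → j ≢ p → lower r j (unit r p ⊕ M) ≡ unit r p ⊕ lower r j M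
  lower-unit-comm r j p M j≢p = Mon-ext entry
    where
    entry : ∀ r′ s → lower r j (unit r p ⊕ M) [ r′ , s ] ≡ (unit r p ⊕ lower r j M) [ r′ , s ]
    entry r′ s rewrite lower-entry r j (unit r p ⊕ M) r′ s | ⊕-entry (unit r p) M r′ s
                     | ⊕-entry (unit r p) (lower r j M) r′ s | lower-entry r j M r′ s
                     | unit-entry r p r′ s | unit-entry r j r′ s
                with r′ Fin.≟ r | s Fin.≟ j
    ... | yes refl | yes refl rewrite dec-false (j Fin.≟ p) j≢p = refl
    ... | yes _    | no _     = refl
    ... | no _     | _        = refl

  unit-injectiveʳ : ∀ {i j s} → unit i j ≡ unit i s → j ≡ s
  unit-injectiveʳ {i} {j} {s} eq with j Fin.≟ s
  ... | yes j≡s = j≡s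
  ... | no j≢s  = ⊥-elim (ℕₚ.1+n≢0 (begin
    1                   ≡⟨ ≡.sym (δ-refl j) ⟩
    δ j j               ≡⟨ ≡.sym (unit-diag i j j) ⟩
    unit i j [ i , j ]  ≡⟨ cong (_[ i , j ]) eq ⟩
    unit i s [ i , j ]  ≡⟨ unit-diag i s j ⟩
    δ j s               ≡⟨ δ-≢ j≢s ⟩
    0                   ∎))
    where open ≡.≡-Reasoning

  Weight : Set
  Weight = Mon → ℕ

  ∂ᵀ : Fin rows → Fin cols → Weight → Weight
  ∂ᵀ r j N M = M [ r , j ] * N (lower r j M)

  unit-⊕-diag : ∀ r p X j → (unit r p ⊕ X) [ r , j ] ≡ δ j p + X [ r , j ]
  unit-⊕-diag r p X j = ≡.trans (⊕-entry (unit r p) X r j) (cong (_+ X [ r , j ]) (unit-diag r p j))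

  ∂ᵀ-leibniz : ∀ N r j p X → ∂ᵀ r j N (unit r p ⊕ X) ≡ δ j p * N X + ∂ᵀ r j (λ M → N (unit r p ⊕ M)) X
  ∂ᵀ-leibniz N r j p X rewrite unit-⊕-diag r p X j with j Fin.≟ p
  ... | no j≢p   = cong (λ M → X [ r , j ] * N M) (lower-unit-comm r j p X j≢p)
  ... | yes refl rewrite lower-unit-⊕ r j X =
    -- if X has no factor x_rj then lower truncates, but that term is multiplied by X[r,j] = 0
    cong₂ _+_ (≡.sym (ℕₚ.*-identityˡ (N X)))
              (*-cong-pos (X [ r , j ]) λ 1≤x → cong N (≡.sym (unit-⊕-lower r j X 1≤x)))
    where
    *-cong-pos : ∀ x {m n} → (1 ≤ x → m ≡ n) → x * m ≡ x * n
    *-cong-pos zero    _  = refl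
    *-cong-pos (suc x) eq = cong (suc x *_) (eq (s≤s z≤n))

  ∂ᵀ-unit : ∀ N r j q → ∂ᵀ r j N (unit r q) ≡ δ j q * N 𝟎
  ∂ᵀ-unit N r j q = begin
    ∂ᵀ r j N (unit r q)
      ≡⟨ cong (∂ᵀ r j N) (≡.sym (⊕-identityʳ (unit r q))) ⟩
    ∂ᵀ r j N (unit r q ⊕ 𝟎)
      ≡⟨ ∂ᵀ-leibniz N r j q 𝟎 ⟩
    δ j q * N 𝟎 + 𝟎 [ r , j ] * N (unit r q ⊕ lower r j 𝟎)
      ≡⟨ cong (λ e → δ j q * N 𝟎 + e * N (unit r q ⊕ lower r j 𝟎)) (𝟎-entry r j) ⟩
    δ j q * N 𝟎 + 0
      ≡⟨ ℕₚ.+-identityʳ _ ⟩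
    δ j q * N 𝟎 ∎
    where open ≡.≡-Reasoning

  ∂ᵀ²-quadratic : ∀ K r j′ j p q →
    ∂ᵀ r j′ (∂ᵀ r j K) (unit r p ⊕ unit r q) ≡ (δ j′ p * δ j q + δ j′ q * δ j p) * K 𝟎
  ∂ᵀ²-quadratic K r j′ j p q = begin
    ∂ᵀ r j′ (∂ᵀ r j K) (unit r p ⊕ unit r q)
      ≡⟨ ∂ᵀ-leibniz (∂ᵀ r j K) r j′ p (unit r q) ⟩
    δ j′ p * ∂ᵀ r j K (unit r q) + ∂ᵀ r j′ (λ M → ∂ᵀ r j K (unit r p ⊕ M)) (unit r q)
      ≡⟨ cong₂ _+_ (cong (δ j′ p *_) (∂ᵀ-unit K r j q)) (∂ᵀ-unit (λ M → ∂ᵀ r j K (unit r p ⊕ M)) r j′ q) ⟩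
    δ j′ p * (δ j q * K 𝟎) + δ j′ q * ∂ᵀ r j K (unit r p ⊕ 𝟎)
      ≡⟨ cong (λ M → δ j′ p * (δ j q * K 𝟎) + δ j′ q * ∂ᵀ r j K M) (⊕-identityʳ (unit r p)) ⟩
    δ j′ p * (δ j q * K 𝟎) + δ j′ q * ∂ᵀ r j K (unit r p)
      ≡⟨ cong (λ n → δ j′ p * (δ j q * K 𝟎) + δ j′ q * n) (∂ᵀ-unit K r j p) ⟩
    δ j′ p * (δ j q * K 𝟎) + δ j′ q * (δ j p * K 𝟎)
      ≡⟨ *-distribʳ-pair (δ j′ p) (δ j q) (δ j′ q) (δ j p) (K 𝟎) ⟩
    (δ j′ p * δ j q + δ j′ q * δ j p) * K 𝟎
      ∎
    where
    open ≡.≡-Reasoning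
    *-distribʳ-pair : ∀ a b c d k → a * (b * k) + c * (d * k) ≡ (a * b + c * d) * k
    *-distribʳ-pair = solve-∀

  ∑-∂ᵀ²-diagonal : ∀ K r j′ j →
    ℕ∑.sum (λ p → ∂ᵀ r j′ (∂ᵀ r j K) (unit r p ⊕ unit r p)) ≡ 2 * (δ j j′ * K 𝟎)
  ∑-∂ᵀ²-diagonal K r j′ j = ≡.trans (ℕ∑.sum-cong-≋ λ p → ≡.trans (∂ᵀ²-quadratic K r j′ j p p)
      (double (δ j′ p) (δ j p) (K 𝟎))) (∑δ-select j′ (λ p → 2 * (δ j p * K 𝟎)))
    where
    double : ∀ a b k → (a * b + a * b) * k ≡ a * (2 * (b * k))
    double = solve-∀

  ∑-∂ᵀ²-offDiagonal : ∀ K r j′ j →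
    ℕ∑.sum (λ p → ℕ∑.sum (λ q → 𝟙 (toℕ p ℕ.<? toℕ q) * ∂ᵀ r j′ (∂ᵀ r j K) (unit r p ⊕ unit r q)))
      ≡ (𝟙 (toℕ j′ ℕ.<? toℕ j) + 𝟙 (toℕ j ℕ.<? toℕ j′)) * K 𝟎
  ∑-∂ᵀ²-offDiagonal K r j′ j = begin
    ℕ∑.sum (λ p → ℕ∑.sum (λ q → lt p q * ∂ᵀ r j′ (∂ᵀ r j K) (unit r p ⊕ unit r q)))
      ≡⟨ ℕ∑.sum-cong-≋ (λ p → ℕ∑.sum-cong-≋ λ q → ≡.trans (cong (lt p q *_) (∂ᵀ²-quadratic K r j′ j p q))
           (split (lt p q) (δ j′ p) (δ j q) (δ j′ q) (δ j p) (K 𝟎))) ⟩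
    ℕ∑.sum (λ p → ℕ∑.sum (λ q → A p q + B p q))
      ≡⟨ ℕ∑.sum-cong-≋ (λ p → ℕ∑.∑-distrib-+ (A p) (B p)) ⟩
    ℕ∑.sum (λ p → ℕ∑.sum (A p) + ℕ∑.sum (B p))
      ≡⟨ ℕ∑.∑-distrib-+ (λ p → ℕ∑.sum (A p)) (λ p → ℕ∑.sum (B p)) ⟩
    ℕ∑.sum (λ p → ℕ∑.sum (A p)) + ℕ∑.sum (λ p → ℕ∑.sum (B p))
      ≡⟨ cong₂ _+_ (∑∑δ-select j′ j (λ p q → lt p q * K 𝟎)) (∑∑δ-select j j′ (λ p q → lt p q * K 𝟎)) ⟩
    lt j′ j * K 𝟎 + lt j j′ * K 𝟎
      ≡⟨ ℕₚ.*-distribʳ-+ (K 𝟎) (lt j′ j) (lt j j′) ⟨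
    (lt j′ j + lt j j′) * K 𝟎 ∎
    where
    open ≡.≡-Reasoning
    lt : Fin cols → Fin cols → ℕ
    lt p q = 𝟙 (toℕ p ℕ.<? toℕ q)
    A B : Fin cols → Fin cols → ℕ
    A p q = δ j′ p * (δ j q * (lt p q * K 𝟎))
    B p q = δ j p * (δ j′ q * (lt p q * K 𝟎))
    split : ∀ l a b c d k → l * ((a * b + c * d) * k) ≡ a * (b * (l * k)) + d * (c * (l * k))
    split = solve-∀

module Pairing {c ℓ} (R : CommutativeRing c ℓ) (rows cols : ℕ) where
  open CommutativeRing R hiding (zero) renaming (refl to ≈-refl)
  open Poly R rows cols
  open Monomials rows cols hiding (Mon)
  open SemiringSum semiring
  open SemiringMult semiring
  open import Data.List using ([]; _∷_)
  import Data.List.Properties as Listₚ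
  open import Relation.Binary.Reasoning.Setoid setoid

  ⟪_∣_⟫ : Pol → Weight → Carrier
  ⟪ [] ∣ N ⟫          = 0#
  ⟪ (d , M) ∷ p ∣ N ⟫ = d * (N M × 1#) + ⟪ p ∣ N ⟫

  point : Mon → Weight
  point T M = 𝟙 (M ≟M T)

  coeff≈⟪point⟫ : ∀ p T → coeff p T ≈ ⟪ p ∣ point T ⟫
  coeff≈⟪point⟫ []            T = ≈-refl
  coeff≈⟪point⟫ ((d , M) ∷ p) T with does (M ≟M T)
  ... | true  = +-cong (sym (trans (*-congˡ (+-identityʳ 1#)) (*-identityʳ d))) (coeff≈⟪point⟫ p T)
  ... | false = trans (sym (+-identityˡ _)) (+-cong (sym (zeroʳ d)) (coeff≈⟪point⟫ p T))

  ⟪⟫-+P : ∀ p q N → ⟪ p +P q ∣ N ⟫ ≈ ⟪ p ∣ N ⟫ + ⟪ q ∣ N ⟫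
  ⟪⟫-+P []            q N = sym (+-identityˡ _)
  ⟪⟫-+P ((d , M) ∷ p) q N = trans (+-congˡ (⟪⟫-+P p q N)) (sym (+-assoc _ _ _))

  ⟪⟫-·P : ∀ a p N → ⟪ a ·P p ∣ N ⟫ ≈ a * ⟪ p ∣ N ⟫
  ⟪⟫-·P a []            N = sym (zeroʳ a)
  ⟪⟫-·P a ((d , M) ∷ p) N = begin
    a * d * (N M × 1#) + ⟪ a ·P p ∣ N ⟫ ≈⟨ +-cong (*-assoc _ _ _) (⟪⟫-·P a p N) ⟩
    a * (d * (N M × 1#)) + a * ⟪ p ∣ N ⟫ ≈⟨ distribˡ a _ _ ⟨
    a * (d * (N M × 1#) + ⟪ p ∣ N ⟫)    ∎

  ΣP-suc : ∀ k (g : Fin (suc k) → Pol) → ΣP (suc k) g ≡ g zero +P ΣP k (λ t → g (suc t))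
  ΣP-suc k g = cong (λ ps → g zero +P Data.List.foldr _+P_ 0P ps)
    (≡.trans (Listₚ.map-tabulate suc g) (≡.sym (Listₚ.map-tabulate (λ t → t) (λ t → g (suc t)))))

  ⟪⟫-ΣP : ∀ k g N → ⟪ ΣP k g ∣ N ⟫ ≈ ∑[ t < k ] ⟪ g t ∣ N ⟫
  ⟪⟫-ΣP zero    g N = ≈-refl
  ⟪⟫-ΣP (suc k) g N = begin
    ⟪ ΣP (suc k) g ∣ N ⟫                         ≡⟨ cong ⟪_∣ N ⟫ (ΣP-suc k g) ⟩
    ⟪ g zero +P ΣP k (λ t → g (suc t)) ∣ N ⟫     ≈⟨ ⟪⟫-+P (g zero) _ N ⟩
    ⟪ g zero ∣ N ⟫ + ⟪ ΣP k (λ t → g (suc t)) ∣ N ⟫ ≈⟨ +-congˡ (⟪⟫-ΣP k (λ t → g (suc t)) N) ⟩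
    ∑[ t < suc k ] ⟪ g t ∣ N ⟫                   ∎

  ⟪⟫-var*P : ∀ i j q N → ⟪ var i j *P q ∣ N ⟫ ≈ ⟪ q ∣ (λ M → N (unit i j ⊕ M)) ⟫
  ⟪⟫-var*P i j []            N = ≈-refl
  ⟪⟫-var*P i j ((e , M) ∷ q) N = +-cong (*-congʳ (*-identityˡ e)) (⟪⟫-var*P i j q N)

  ⟪⟫-∂ : ∀ r j p N → ⟪ ∂ r j p ∣ N ⟫ ≈ ⟪ p ∣ ∂ᵀ r j N ⟫
  ⟪⟫-∂ r j []            N = ≈-refl
  ⟪⟫-∂ r j ((d , M) ∷ p) N = +-cong (begin
    (M [ r , j ] × d) * (N (lower r j M) × 1#)   ≈⟨ ×-assoc-* (M [ r , j ]) d _ ⟩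
    M [ r , j ] × (d * (N (lower r j M) × 1#))   ≈⟨ ×-comm-* (M [ r , j ]) d _ ⟨
    d * (M [ r , j ] × (N (lower r j M) × 1#))   ≈⟨ *-congˡ (×-assocˡ 1# (M [ r , j ]) _) ⟩
    d * (∂ᵀ r j N M × 1#)                        ∎) (⟪⟫-∂ r j p N)

  ⟪⟫-var*var : ∀ r p q N → ⟪ var r p *P var r q ∣ N ⟫ ≈ N (unit r p ⊕ unit r q) × 1#
  ⟪⟫-var*var r p q N = trans (⟪⟫-var*P r p (var r q) N) (trans (+-identityʳ _) (*-identityˡ _))

  ∑-×1# : ∀ {k} (g : Fin k → ℕ) → ∑[ t < k ] (g t × 1#) ≈ ℕ∑.sum g × 1#
  ∑-×1# {zero}  g = ≈-refl
  ∑-×1# {suc k} g = trans (+-congˡ (∑-×1# (λ t → g (suc t)))) (sym (×-homo-+ 1# (g zero) _))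

  ⟪⟫-if : ∀ {p} {P : Set p} (P? : Dec P) X N n → ⟪ X ∣ N ⟫ ≈ n × 1# →
          ⟪ if does P? then X else 0P ∣ N ⟫ ≈ (𝟙 P? ℕ.* n) × 1#
  ⟪⟫-if P? X N n eq with does P?
  ... | true  = trans eq (×-congˡ (≡.sym (ℕₚ.+-identityʳ n)))
  ... | false = ≈-refl

  ⟪⟫-m₂ : ∀ r N → ⟪ m₂ r ∣ N ⟫ ≈ ℕ∑.sum (λ p → N (unit r p ⊕ unit r p)) × 1#
  ⟪⟫-m₂ r N = trans (⟪⟫-ΣP cols (λ p → var r p *P var r p) N)
    (trans (sum-cong-≋ (λ p → ⟪⟫-var*var r p p N)) (∑-×1# (λ p → N (unit r p ⊕ unit r p))))

  ⟪⟫-m₁₁ : ∀ r N → ⟪ m₁₁ r ∣ N ⟫ ≈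
    ℕ∑.sum (λ p → ℕ∑.sum (λ q → 𝟙 (toℕ p ℕ.<? toℕ q) ℕ.* N (unit r p ⊕ unit r q))) × 1#
  ⟪⟫-m₁₁ r N = trans (⟪⟫-ΣP cols (λ p → ΣP cols (x₁₁ p)) N)
    (trans (sum-cong-≋ row) (∑-×1# (λ p → ℕ∑.sum (n₁₁ p))))
    where
    x₁₁ : Fin cols → Fin cols → Pol
    x₁₁ p q = if does (toℕ p ℕ.<? toℕ q) then var r p *P var r q else 0P
    n₁₁ : Fin cols → Fin cols → ℕ
    n₁₁ p q = 𝟙 (toℕ p ℕ.<? toℕ q) ℕ.* N (unit r p ⊕ unit r q)
    row : ∀ p → ⟪ ΣP cols (x₁₁ p) ∣ N ⟫ ≈ ℕ∑.sum (n₁₁ p) × 1#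
    row p = trans (⟪⟫-ΣP cols (x₁₁ p) N) (trans (sum-cong-≋ (λ q →
      ⟪⟫-if (toℕ p ℕ.<? toℕ q) (var r p *P var r q) N _ (⟪⟫-var*var r p q N))) (∑-×1# (n₁₁ p)))

  coeff-linear : ∀ k (γ : Fin k → Carrier) (v : Fin k → Pol) T →
    coeff (ΣP k (λ t → γ t ·P v t)) T ≈ ∑[ t < k ] (γ t * coeff (v t) T)
  coeff-linear k γ v T = begin
    coeff (ΣP k (λ t → γ t ·P v t)) T      ≈⟨ coeff≈⟪point⟫ (ΣP k (λ t → γ t ·P v t)) T ⟩
    ⟪ ΣP k (λ t → γ t ·P v t) ∣ point T ⟫  ≈⟨ ⟪⟫-ΣP k (λ t → γ t ·P v t) (point T) ⟩
    ∑[ t < k ] ⟪ γ t ·P v t ∣ point T ⟫    ≈⟨ sum-cong-≋ (λ t → ⟪⟫-·P (γ t) (v t) (point T)) ⟩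
    ∑[ t < k ] (γ t * ⟪ v t ∣ point T ⟫)   ≈⟨ sum-cong-≋ (λ t → *-congˡ (coeff≈⟪point⟫ (v t) T)) ⟨
    ∑[ t < k ] (γ t * coeff (v t) T)       ∎

  quadratic : Carrier → Carrier → Fin rows → Pol
  quadratic a b r = (a ·P m₂ r) +P (b ·P m₁₁ r)

  ⟪⟫-quadratic : ∀ a b r N → ⟪ quadratic a b r ∣ N ⟫ ≈
    a * (ℕ∑.sum (λ p → N (unit r p ⊕ unit r p)) × 1#) +
    b * (ℕ∑.sum (λ p → ℕ∑.sum (λ q → 𝟙 (toℕ p ℕ.<? toℕ q) ℕ.* N (unit r p ⊕ unit r q))) × 1#)
  ⟪⟫-quadratic a b r N = begin
    ⟪ quadratic a b r ∣ N ⟫                  ≈⟨ ⟪⟫-+P (a ·P m₂ r) (b ·P m₁₁ r) N ⟩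
    ⟪ a ·P m₂ r ∣ N ⟫ + ⟪ b ·P m₁₁ r ∣ N ⟫  ≈⟨ +-cong (⟪⟫-·P a (m₂ r) N) (⟪⟫-·P b (m₁₁ r) N) ⟩
    a * ⟪ m₂ r ∣ N ⟫ + b * ⟪ m₁₁ r ∣ N ⟫    ≈⟨ +-cong (*-congˡ (⟪⟫-m₂ r N)) (*-congˡ (⟪⟫-m₁₁ r N)) ⟩
    _                                        ∎

  hessian : Carrier → Carrier → Fin cols → Fin cols → Carrier
  hessian a b j′ j = if does (j′ Fin.≟ j) then a + a else b

  hessian-diag : ∀ a b j → hessian a b j j ≡ a + a
  hessian-diag a b j = cong (λ z → if z then a + a else b) (dec-true (j Fin.≟ j) refl)

  ⟪⟫-quadratic-∂ᵀ² : ∀ a b r K j′ j →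
    ⟪ quadratic a b r ∣ ∂ᵀ r j′ (∂ᵀ r j K) ⟫ ≈ hessian a b j′ j * (K 𝟎 × 1#)
  ⟪⟫-quadratic-∂ᵀ² a b r K j′ j = trans (⟪⟫-quadratic a b r _)
    (trans (+-cong (*-congˡ (×-congˡ (∑-∂ᵀ²-diagonal K r j′ j)))
                   (*-congˡ (×-congˡ (∑-∂ᵀ²-offDiagonal K r j′ j))))
           (by-cases (K 𝟎)))
    where
    by-cases : ∀ k → a * ((2 ℕ.* (δ j j′ ℕ.* k)) × 1#) +
                     b * (((𝟙 (toℕ j′ ℕ.<? toℕ j) ℕ.+ 𝟙 (toℕ j ℕ.<? toℕ j′)) ℕ.* k) × 1#)
                   ≈ hessian a b j′ j * (k × 1#)
    by-cases k with j′ Fin.≟ j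
    ... | yes refl rewrite δ-refl j | 𝟙[<]-irrefl j = begin
      a * ((2 ℕ.* (1 ℕ.* k)) × 1#) + b * 0#  ≈⟨ +-cong (*-congˡ (×-congˡ (two-k k))) (zeroʳ b) ⟩
      a * ((k ℕ.+ k) × 1#) + 0#              ≈⟨ +-identityʳ _ ⟩
      a * ((k ℕ.+ k) × 1#)                   ≈⟨ *-congˡ (×-homo-+ 1# k k) ⟩
      a * (k × 1# + k × 1#)                  ≈⟨ distribˡ a _ _ ⟩
      a * (k × 1#) + a * (k × 1#)            ≈⟨ distribʳ _ a a ⟨
      (a + a) * (k × 1#)                     ∎
      where
      two-k : ∀ k → 2 ℕ.* (1 ℕ.* k) ≡ k ℕ.+ k
      two-k = solve-∀
    ... | no j′≢j rewrite δ-≢ (j′≢j ∘ ≡.sym) | 𝟙[<]-connex j′≢j = begin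
      a * 0# + b * ((k ℕ.+ 0) × 1#)  ≈⟨ +-cong (zeroʳ a) (*-congˡ (×-congˡ (ℕₚ.+-identityʳ k))) ⟩
      0# + b * (k × 1#)              ≈⟨ +-identityˡ _ ⟩
      b * (k × 1#)                   ∎

  point-unit : ∀ i s j → point (unit i s) (unit i j ⊕ 𝟎) ≡ δ s j
  point-unit i s j rewrite ⊕-identityʳ (unit i j) with unit i j ≟M unit i s | s Fin.≟ j
  ... | yes _    | yes _    = refl
  ... | no _     | no _     = refl
  ... | yes eq   | no s≢j   = ⊥-elim (s≢j (≡.sym (unit-injectiveʳ eq)))
  ... | no ne    | yes refl = ⊥-elim (ne refl)

  open Selection semiring using (∑-select)

  coeff-E∂∂-quadratic : ∀ a b r (σ : Fin cols → Fin cols) i s →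
    coeff (ΣP cols (λ j → var i j *P ∂ r j (∂ r (σ j) (quadratic a b r)))) (unit i s) ≈ hessian a b (σ s) s
  coeff-E∂∂-quadratic a b r σ i s = begin
    coeff (ΣP cols v) (unit i s)             ≈⟨ coeff≈⟪point⟫ (ΣP cols v) (unit i s) ⟩
    ⟪ ΣP cols v ∣ P ⟫                        ≈⟨ ⟪⟫-ΣP cols v P ⟩
    ∑[ j < cols ] ⟪ v j ∣ P ⟫
      ≈⟨ sum-cong-≋ term ⟩
    ∑[ j < cols ] (δ s j × hessian a b (σ j) j)
      ≈⟨ ∑-select s (λ j → hessian a b (σ j) j) ⟩
    hessian a b (σ s) s ∎
    where
    f : Pol
    f = quadratic a b r
    v : Fin cols → Pol
    v j = var i j *P ∂ r j (∂ r (σ j) f)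
    P : Weight
    P = point (unit i s)
    term : ∀ j → ⟪ v j ∣ P ⟫ ≈ δ s j × hessian a b (σ j) j
    term j = begin
      ⟪ var i j *P ∂ r j (∂ r (σ j) f) ∣ P ⟫          ≈⟨ ⟪⟫-var*P i j (∂ r j (∂ r (σ j) f)) P ⟩
      ⟪ ∂ r j (∂ r (σ j) f) ∣ Pⱼ ⟫                    ≈⟨ ⟪⟫-∂ r j (∂ r (σ j) f) Pⱼ ⟩
      ⟪ ∂ r (σ j) f ∣ ∂ᵀ r j Pⱼ ⟫                     ≈⟨ ⟪⟫-∂ r (σ j) f (∂ᵀ r j Pⱼ) ⟩
      ⟪ f ∣ ∂ᵀ r (σ j) (∂ᵀ r j Pⱼ) ⟫                  ≈⟨ ⟪⟫-quadratic-∂ᵀ² a b r Pⱼ (σ j) j ⟩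
      hessian a b (σ j) j * (Pⱼ 𝟎 × 1#)               ≈⟨ *-congˡ (×-congˡ (point-unit i s j)) ⟩
      hessian a b (σ j) j * (δ s j × 1#)              ≈⟨ ×-comm-* (δ s j) _ 1# ⟩
      δ s j × (hessian a b (σ j) j * 1#)              ≈⟨ ×-congʳ (δ s j) (*-identityʳ _) ⟩
      δ s j × hessian a b (σ j) j                     ∎
      where
      Pⱼ : Weight
      Pⱼ M = P (unit i j ⊕ M)

module CharZeroField {c ℓ} {R : CommutativeRing c ℓ} (F : IsCharZeroField R) where
  open CommutativeRing R hiding (zero) renaming (refl to ≈-refl)
  open IsCharZeroField F
  open import Algebra.Properties.Ring ring using (x∙y⁻¹≈ε⇒x≈y; +-identityʳ-unique)
  open SemiringSum semiring
  open SemiringMult semiring using (_×_)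
  open Selection semiring using (∑-select)
  open import Relation.Binary.Reasoning.Setoid setoid

  x*y≈0⇒x≈0 : ∀ {x y} → ¬ (y ≈ 0#) → x * y ≈ 0# → x ≈ 0#
  x*y≈0⇒x≈0 {x} {y} y≉0 xy≈0 with inverse y y≉0
  ... | y⁻¹ , yy⁻¹≈1 = begin
    x              ≈⟨ *-identityʳ x ⟨
    x * 1#         ≈⟨ *-congˡ yy⁻¹≈1 ⟨
    x * (y * y⁻¹)  ≈⟨ *-assoc x y y⁻¹ ⟨
    x * y * y⁻¹    ≈⟨ *-congʳ xy≈0 ⟩
    0# * y⁻¹       ≈⟨ zeroˡ y⁻¹ ⟩
    0#             ∎

  x+x≉0 : ∀ {x} → ¬ (x ≈ 0#) → ¬ (x + x ≈ 0#)
  x+x≉0 {x} x≉0 x+x≈0 = x≉0 (x*y≈0⇒x≈0 (charZero 1) (begin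
    x * (1# + (1# + 0#))    ≈⟨ *-congˡ (+-congˡ (+-identityʳ 1#)) ⟩
    x * (1# + 1#)           ≈⟨ distribˡ x 1# 1# ⟩
    x * 1# + x * 1#         ≈⟨ +-cong (*-identityʳ x) (*-identityʳ x) ⟩
    x + x                   ≈⟨ x+x≈0 ⟩
    0#                      ∎))

  columns-independent : ∀ {m d b} → ¬ (d ≈ 0#) → ¬ (b ≈ d) → (γ : Fin (suc m) → Carrier) →
    (∀ s → γ zero * d + ∑[ t < m ] (γ (suc t) * (if does (inject₁ t Fin.≟ s) then d else b)) ≈ 0#) →
    ∀ t → γ t ≈ 0#
  columns-independent {m} {d} {b} d≉0 b≉d γ equation = γ≈0
    where
    h : Fin (suc m) → Fin (suc m) → Carrier
    h x y = if does (x Fin.≟ y) then d else b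

    β : Carrier
    β = ∑[ t < m ] (γ (suc t) * b)

    last-column : γ zero * d + β ≈ 0#
    last-column = trans (+-congˡ (sum-cong-≋ (λ t → *-congˡ (reflexive (≡.sym (off-diagonal t))))))
                        (equation (fromℕ m))
      where
      off-diagonal : ∀ t → h (inject₁ t) (fromℕ m) ≡ b
      off-diagonal t rewrite dec-false (inject₁ t Fin.≟ fromℕ m) (Finₚ.fromℕ≢inject₁ ∘ ≡.sym) = refl

    b+[d-b]≈d : b + (d - b) ≈ d
    b+[d-b]≈d = begin
      b + (d - b)     ≈⟨ +-congˡ (+-comm d (- b)) ⟩
      b + (- b + d)   ≈⟨ +-assoc b (- b) d ⟨
      (b - b) + d     ≈⟨ +-congʳ (-‿inverseʳ b) ⟩
      0# + d          ≈⟨ +-identityˡ d ⟩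
      d               ∎

    inner-column : ∀ t₀ → ∑[ t < m ] (γ (suc t) * h (inject₁ t) (inject₁ t₀)) ≈ β + γ (suc t₀) * (d - b)
    inner-column t₀ = begin
      ∑[ t < m ] (γ (suc t) * h (inject₁ t) (inject₁ t₀))
        ≈⟨ sum-cong-≋ split ⟩
      ∑[ t < m ] (γ (suc t) * b + δ t₀ t × (γ (suc t) * (d - b)))
        ≈⟨ ∑-distrib-+ (λ t → γ (suc t) * b) (λ t → δ t₀ t × (γ (suc t) * (d - b))) ⟩
      β + ∑[ t < m ] (δ t₀ t × (γ (suc t) * (d - b)))
        ≈⟨ +-congˡ (∑-select t₀ (λ t → γ (suc t) * (d - b))) ⟩
      β + γ (suc t₀) * (d - b) ∎
      where
      split : ∀ t → γ (suc t) * h (inject₁ t) (inject₁ t₀) ≈ γ (suc t) * b + δ t₀ t × (γ (suc t) * (d - b))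
      split t with t₀ Fin.≟ t
      ... | yes refl rewrite dec-true (inject₁ t Fin.≟ inject₁ t) refl = begin
        γ (suc t) * d                               ≈⟨ *-congˡ b+[d-b]≈d ⟨
        γ (suc t) * (b + (d - b))                   ≈⟨ distribˡ (γ (suc t)) b (d - b) ⟩
        γ (suc t) * b + γ (suc t) * (d - b)         ≈⟨ +-congˡ (+-identityʳ _) ⟨
        γ (suc t) * b + (γ (suc t) * (d - b) + 0#)  ∎
      ... | no t₀≢t rewrite dec-false (inject₁ t Fin.≟ inject₁ t₀) (t₀≢t ∘ ≡.sym ∘ Finₚ.inject₁-injective) =
        sym (+-identityʳ _)

    γ≈0 : ∀ t → γ t ≈ 0#
    γ≈0 (suc t₀) = x*y≈0⇒x≈0 (λ d-b≈0 → b≉d (sym (x∙y⁻¹≈ε⇒x≈y d b d-b≈0)))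
      (+-identityʳ-unique (γ zero * d + β) (γ (suc t₀) * (d - b)) (begin
        γ zero * d + β + γ (suc t₀) * (d - b)
          ≈⟨ +-assoc _ _ _ ⟩
        γ zero * d + (β + γ (suc t₀) * (d - b))
          ≈⟨ +-congˡ (inner-column t₀) ⟨
        γ zero * d + ∑[ t < m ] (γ (suc t) * h (inject₁ t) (inject₁ t₀))
          ≈⟨ equation (inject₁ t₀) ⟩
        0#
          ≈⟨ last-column ⟨
        γ zero * d + β ∎))
    γ≈0 zero = x*y≈0⇒x≈0 d≉0 (begin
      γ zero * d       ≈⟨ +-identityʳ _ ⟨
      γ zero * d + 0#  ≈⟨ +-congˡ β≈0 ⟨
      γ zero * d + β   ≈⟨ last-column ⟩
      0#               ∎)
      where
      β≈0 : β ≈ 0#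
      β≈0 = trans (sum-cong-≋ (λ t → trans (*-congʳ (γ≈0 (suc t))) (zeroˡ b))) (sum-replicate-zero m)

open import Data.Vec.Functional using (_∷_)

mainTheorem19 : ∀ {c ℓ′ : Level} (R : CommutativeRing c ℓ′) → IsCharZeroField R →
    (k m : ℕ) → 1 ≤ m →
    let open Poly R (suc k) (suc m)
    in (a b : CommutativeRing.Carrier R) →
    ¬ (CommutativeRing._≈_ R a (CommutativeRing.0# R)) →
    ¬ (CommutativeRing._≈_ R b (CommutativeRing._+_ R a a)) →
    let f = (a ·P m₂ zero) +P (b ·P m₁₁ zero)
    in (i : Fin (suc k)) →
    LinearlyIndependent (E^ 2 i zero f ∷ (λ j → E i zero (∂ zero (inject₁ j) f)))
mainTheorem19 R fld k m _ a b a≉0 b≉a+a i γ combination≈0 =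
  columns-independent (x+x≉0 a≉0) b≉a+a γ equation
  where
  open CommutativeRing R hiding (zero)
  open Poly R (suc k) (suc m)
  open Pairing R (suc k) (suc m)
  open Monomials (suc k) (suc m) using (unit)
  open CharZeroField fld
  open SemiringSum semiring using (sum-syntax; sum-cong-≋)
  open import Relation.Binary.Reasoning.Setoid setoid

  v : Fin (suc m) → Pol
  v = E^ 2 i zero (quadratic a b zero) ∷ (λ t → E i zero (∂ zero (inject₁ t) (quadratic a b zero)))

  equation : ∀ s → γ zero * (a + a) + ∑[ t < m ] (γ (suc t) * hessian a b (inject₁ t) s) ≈ 0#
  equation s = begin
    γ zero * (a + a) + ∑[ t < m ] (γ (suc t) * hessian a b (inject₁ t) s)
      ≈⟨ +-cong (*-congˡ (sym diagonal)) (sum-cong-≋ λ t →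
           *-congˡ (sym (coeff-E∂∂-quadratic a b zero (λ _ → inject₁ t) i s))) ⟩
    ∑[ t < suc m ] (γ t * coeff (v t) (unit i s))     ≈⟨ coeff-linear (suc m) γ v (unit i s) ⟨
    coeff (ΣP (suc m) (λ t → γ t ·P v t)) (unit i s) ≈⟨ combination≈0 (unit i s) ⟩
    0#                                               ∎
    where
    diagonal : coeff (v zero) (unit i s) ≈ a + a
    diagonal = trans (coeff-E∂∂-quadratic a b zero (λ j → j) i s) (reflexive (hessian-diag a b s))
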